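{- Let $G = P_n^k$ be the $k$-th power of the path $P_n$, with $n \ge 3$ and $2 \le k < n$. Then $G$ is gap-vertex-labelable if and only if either (i) $G$ is isomorphic to $P_3^2$ or $P_4^2$; or (ii) $n \ge 5$ and $k < n/2$.
   Context: $P_n$ is the path on $n$ vertices. The $k$-th power $H^k$ of a graph $H$ has vertex set $V(H)$ and edges $uv$ for all distinct $u,v$ with $\mathrm{dist}_H(u,v) \le k$. For $m \in \mathbb{N}$ and $[m] = \{1, \ldots, m\}$, a gap-$[m]$-vertex-labelling of a connected graph $G$ is a pair $(\pi, c_\pi)$ where $\pi : V(G) \to [m]$ and $c_\pi : V(G) \to \{0, 1, \ldots, m\}$ is a proper vertex colouring of $G$ such that for every $v \in V(G)$: if $d(v) \ge 2$ then $c_\pi(v) = \max_{u \in N(v)} \pi(u) - \min_{u \in N(v)} \pi(u)$, and if $d(v) = 1$ then $c_\pi(v) = \pi(u)$ where $u$ is the unique neighbour of $v$. $G$ is gap-vertex-labelable if it admits a gap-$[m]$-vertex-labelling for some $m \in \mathbb{N}$. -}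

module Defs where

open import Data.Nat using (ℕ; _≤_; _<_; _∸_; ∣_-_∣; suc)
open import Data.Fin using (Fin; toℕ)
open import Data.Product using (Σ; ∃; ∃-syntax; _×_; _,_)
open import Function.Bundles using (_↔_; Inverse)
open import Relation.Binary.PropositionalEquality using (_≡_; _≢_)
open import Relation.Nullary using (¬_)

record Graph : Set₁ where
  field
    size : ℕ
    Adj  : Fin size → Fin size → Set
    sym  : ∀ {u v} → Adj u v → Adj v u
    irr  : ∀ {u} → ¬ Adj u u
open Graph public

-- Path P_n on vertices 0..n-1 (i ~ i+1); dist_{P_n}(i,j) = ∣ i - j ∣.
-- k-th power P_n^k : i ~ j  iff  i ≠ j and dist_{P_n}(i,j) ≤ k.
PathPower : ℕ → ℕ → Graph
PathPower n k = record
  { size = n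
  ; Adj  = λ i j → (i ≢ j) × (∣ toℕ i - toℕ j ∣ ≤ k)
  ; sym  = λ { {i} {j} (i≢j , d) → (λ e → i≢j (symm e)) , subst≤ {toℕ i} {toℕ j} d }
  ; irr  = λ { (i≢i , _) → i≢i _≡_.refl }
  }
  where
  open import Relation.Binary.PropositionalEquality using () renaming (sym to symm)
  open import Data.Nat.Properties using (∣-∣-comm)
  subst≤ : ∀ {a b} → ∣ a - b ∣ ≤ k → ∣ b - a ∣ ≤ k
  subst≤ {a} {b} d rewrite ∣-∣-comm a b = d

_≅_ : Graph → Graph → Set
G ≅ H = Σ (Fin (size G) ↔ Fin (size H)) λ f →
          ∀ u v → (Adj G u v → Adj H (Inverse.to f u) (Inverse.to f v))
                × (Adj H (Inverse.to f u) (Inverse.to f v) → Adj G u v)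

DegOne : (G : Graph) → Fin (size G) → Set
DegOne G v = ∃[ u ] (Adj G v u × (∀ w → Adj G v w → w ≡ u))

DegAtLeast2 : (G : Graph) → Fin (size G) → Set
DegAtLeast2 G v = ∃[ u ] ∃[ w ] (u ≢ w × Adj G v u × Adj G v w)

IsMaxN : (G : Graph) → (Fin (size G) → ℕ) → Fin (size G) → ℕ → Set
IsMaxN G π v x = (∃[ u ] (Adj G v u × π u ≡ x)) × (∀ u → Adj G v u → π u ≤ x)

IsMinN : (G : Graph) → (Fin (size G) → ℕ) → Fin (size G) → ℕ → Set
IsMinN G π v x = (∃[ u ] (Adj G v u × π u ≡ x)) × (∀ u → Adj G v u → x ≤ π u)

record GapLabelling (G : Graph) (m : ℕ) : Set where
  field
    π      : Fin (size G) → ℕ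
    c      : Fin (size G) → ℕ
    π-range : ∀ v → 1 ≤ π v × π v ≤ m
    c-range : ∀ v → c v ≤ m
    proper  : ∀ u v → Adj G u v → c u ≢ c v
    gap≥2   : ∀ v → DegAtLeast2 G v →
              ∃[ M ] ∃[ μ ] (IsMaxN G π v M × IsMinN G π v μ × c v ≡ M ∸ μ)
    gap1    : ∀ v → DegOne G v → ∀ u → Adj G v u → c v ≡ π u

GapVertexLabelable : Graph → Set
GapVertexLabelable G = ∃[ m ] GapLabelling G m

module Submission where

-- If 2k < n, take π(v) = 2 ^ v. The gap at v is then 2 ^ max N(v) ∸ 2 ^ min N(v), and a
-- difference of two powers of two determines both exponents, so the colouring is proper as soon
-- as distinct vertices differ in their smallest or largest neighbour, which 2k < n guarantees.
-- P₃² and P₄² have explicit labellings. If n ≤ 2k and k ≥ 3, any two vertices have two adjacent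
-- common neighbours; taking them for a maximiser x and a minimiser y of π, both neighbours get
-- the colour π x ∸ π y, contradicting properness. What remains is k = 2, n ≤ 4.

open import Defs renaming (sym to Adj-sym)
open import Data.Nat
open import Data.Nat.Properties
open import Data.Empty using (⊥; ⊥-elim)
open import Data.Fin as Fin using (Fin; toℕ; fromℕ<)
open import Data.Fin.Properties using (toℕ-fromℕ<; toℕ<n; toℕ-injective; any?; all?; ¬∀⟶∃¬; pigeonhole)
open import Data.List using (List; []; _∷_; length; allFin)
open import Data.List.Extrema.Nat using (argmax; argmin; f[xs]≤f[argmax]; f[argmin]≤f[xs])
open import Data.List.Membership.DecPropositional _≟_ using (_∈?_)
open import Data.List.Membership.Propositional using (_∈_; _∉_)
open import Data.List.Membership.Propositional.Properties using (∈-allFin)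
open import Data.List.Membership.Setoid.Properties using (index-injective)
open import Data.List.Relation.Unary.All as All using ()
open import Data.List.Relation.Unary.Any using (here; there; index)
open import Data.Product using (∃₂; ∃-syntax; _×_; _,_; proj₁; proj₂)
open import Data.Sum using (_⊎_; inj₁; inj₂; map₂)
open import Data.Vec as Vec using (_∷_; [])
open import Function using (_∘_; id; _⇔_; mk⇔; Inverse)
open import Function.Construct.Identity using (↔-id)
open import Relation.Binary.Definitions using (tri<; tri≈; tri>)
open import Relation.Binary.PropositionalEquality
open import Relation.Nullary using (¬_; Dec; yes; no)
open import Relation.Nullary.Decidable using (from-yes; _×-dec_; _→-dec_; ¬?)

2*m≡m+m : ∀ m → 2 * m ≡ m + m
2*m≡m+m m = cong (m +_) (+-identityʳ m)

∣-∣≤-intro : ∀ {m n o} → m ≤ n + o → n ≤ m + o → ∣ m - n ∣ ≤ o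
∣-∣≤-intro {m} {n} m≤n+o n≤m+o with ≤-total m n
... | inj₁ m≤n rewrite m≤n⇒∣m-n∣≡n∸m m≤n = m≤n+o⇒m∸n≤o n m n≤m+o
... | inj₂ n≤m rewrite m≤n⇒∣n-m∣≡n∸m n≤m = m≤n+o⇒m∸n≤o m n m≤n+o

∣-∣≤-elim : ∀ {m n o} → ∣ m - n ∣ ≤ o → m ≤ n + o × n ≤ m + o
∣-∣≤-elim {m} {n} d = ≤-trans (m≤n+∣m-n∣ m n) (+-monoʳ-≤ n d)
                    , ≤-trans (m≤n+∣n-m∣ n m) (+-monoʳ-≤ m d)

∸-monoˡ-<′ : ∀ {m n o} → m < n → o < n → m ∸ o < n ∸ o
∸-monoˡ-<′ {m} {n} {o} m<n o<n with ≤-total o m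
... | inj₁ o≤m = ∸-monoˡ-< m<n o≤m
... | inj₂ m≤o rewrite m≤n⇒m∸n≡0 m≤o = m<n⇒0<n∸m o<n

2^-exponent-unique : ∀ {a b x} → 2 ^ a ≤ x → x < 2 ^ suc a → 2 ^ b ≤ x → x < 2 ^ suc b → a ≡ b
2^-exponent-unique {a} {b} 2^a≤x x<2^1+a 2^b≤x x<2^1+b with <-cmp a b
... | tri< a<b _ _ = ⊥-elim (<-irrefl refl (<-≤-trans x<2^1+a (≤-trans (^-monoʳ-≤ 2 a<b) 2^b≤x)))
... | tri≈ _ a≡b _ = a≡b
... | tri> _ _ b<a = ⊥-elim (<-irrefl refl (<-≤-trans x<2^1+b (≤-trans (^-monoʳ-≤ 2 b<a) 2^a≤x)))

2^-injective : ∀ {a b} → 2 ^ a ≡ 2 ^ b → a ≡ b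
2^-injective {a} {b} e =
  2^-exponent-unique ≤-refl (2^<2^suc a) (≤-reflexive (sym e)) (subst (_< 2 ^ suc b) (sym e) (2^<2^suc b))
  where
  2^<2^suc : ∀ a → 2 ^ a < 2 ^ suc a
  2^<2^suc a = ^-monoʳ-< 2 (s≤s (s≤s z≤n)) (n<1+n a)

2^l≤2^[1+r] : ∀ {l r} → l ≤ r → 2 ^ l ≤ 2 ^ suc r
2^l≤2^[1+r] l≤r = ^-monoʳ-≤ 2 (m≤n⇒m≤1+n l≤r)

2^r≤2^[1+r]∸2^l : ∀ {l r} → l ≤ r → 2 ^ r ≤ 2 ^ suc r ∸ 2 ^ l
2^r≤2^[1+r]∸2^l {l} {r} l≤r =
  m+n≤o⇒m≤o∸n (2 ^ r)
    (+-monoʳ-≤ (2 ^ r) (≤-trans (^-monoʳ-≤ 2 l≤r) (≤-reflexive (sym (+-identityʳ _)))))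

2^[1+r]∸2^l<2^[1+r] : ∀ {l r} → l ≤ r → 2 ^ suc r ∸ 2 ^ l < 2 ^ suc r
2^[1+r]∸2^l<2^[1+r] {l} l≤r = ∸-monoʳ-< (m^n>0 2 l) (2^l≤2^[1+r] l≤r)

-- 2 ^ r ∸ 2 ^ l lies in [2 ^ (r - 1), 2 ^ r), which pins down r and then l.
2^∸2^-injective : ∀ {l r l′ r′} → l < r → l′ < r′ →
                  2 ^ r ∸ 2 ^ l ≡ 2 ^ r′ ∸ 2 ^ l′ → l ≡ l′ × r ≡ r′
2^∸2^-injective {l} {suc r} {l′} {suc r′} (s≤s l≤r) (s≤s l′≤r′) e
  with 2^-exponent-unique {r} {r′} (2^r≤2^[1+r]∸2^l l≤r) (2^[1+r]∸2^l<2^[1+r] l≤r)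
         (subst (2 ^ r′ ≤_) (sym e) (2^r≤2^[1+r]∸2^l l′≤r′))
         (subst (_< 2 ^ suc r′) (sym e) (2^[1+r]∸2^l<2^[1+r] l′≤r′))
... | refl = 2^-injective (∸-cancelˡ-≡ (2^l≤2^[1+r] l≤r) (2^l≤2^[1+r] l′≤r′) e) , refl

gap-in-interval : ∀ (xs : List ℕ) s → ∃[ i ] s ≤ i × i ≤ s + length xs × i ∉ xs
gap-in-interval xs s =
  let (o , o∉xs) = ¬∀⟶∃¬ _ (λ o → s + toℕ o ∈ xs) (λ o → s + toℕ o ∈? xs) not-all
  in s + toℕ o , m≤m+n s _ , +-monoʳ-≤ s (s≤s⁻¹ (toℕ<n o)) , o∉xs
  where
  not-all : ¬ (∀ (o : Fin (suc (length xs))) → s + toℕ o ∈ xs)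
  not-all all-in with pigeonhole (n<1+n (length xs)) (index ∘ all-in)
  ... | o , o′ , o<o′ , same-index =
    <⇒≢ o<o′ (+-cancelˡ-≡ s _ _ (index-injective (setoid ℕ) (all-in o) (all-in o′) same-index))

AdjacentCommonNeighbours : (G : Graph) → Fin (size G) → Fin (size G) → Set
AdjacentCommonNeighbours G a b =
  ∃₂ λ v w → Adj G v w × (Adj G v a × Adj G v b) × (Adj G w a × Adj G w b)

gap-between-extremes : ∀ {G m} (L : GapLabelling G m) → let open GapLabelling L in
  ∀ {x y v} → (∀ u → π u ≤ π x) → (∀ u → π y ≤ π u) →
  DegAtLeast2 G v → Adj G v x → Adj G v y → c v ≡ π x ∸ π y
gap-between-extremes L {x} {y} {v} ≤πx πy≤ deg v~x v~y with GapLabelling.gap≥2 L v deg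
... | M , μ , ((u , _ , πu≡M) , ≤M) , ((w , _ , πw≡μ) , μ≤) , cv≡M∸μ =
  trans cv≡M∸μ (cong₂ _∸_ (≤-antisym (subst (_≤ π x) πu≡M (≤πx u)) (≤M x v~x))
                          (≤-antisym (μ≤ y v~y) (subst (π y ≤_) πw≡μ (πy≤ w))))
  where open GapLabelling L

common-neighbours-sym : ∀ {G a b} → AdjacentCommonNeighbours G a b → AdjacentCommonNeighbours G b a
common-neighbours-sym (v , w , v~w , (v~a , v~b) , (w~a , w~b)) = v , w , v~w , (v~b , v~a) , (w~b , w~a)

no-gap-labelling : ∀ {G m} → Fin (size G) → (∀ a b → AdjacentCommonNeighbours G a b) →
                   ¬ GapLabelling G m
no-gap-labelling {G} v₀ common L = clash (common x y)
  where
  open GapLabelling L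
  x = argmax π v₀ (allFin (size G))
  y = argmin π v₀ (allFin (size G))

  deg≥2 : ∀ u → DegAtLeast2 G u
  deg≥2 u with common u u
  ... | a , b , a~b , (a~u , _) , (b~u , _) =
    a , b , (λ a≡b → irr G (subst (Adj G a) (sym a≡b) a~b)) , Adj-sym G a~u , Adj-sym G b~u

  colour : ∀ {u} → Adj G u x × Adj G u y → c u ≡ π x ∸ π y
  colour (u~x , u~y) = gap-between-extremes L
    (λ u → All.lookup (f[xs]≤f[argmax] v₀ _) (∈-allFin u))
    (λ u → All.lookup (f[argmin]≤f[xs] v₀ _) (∈-allFin u))
    (deg≥2 _) u~x u~y

  clash : AdjacentCommonNeighbours G x y → ⊥
  clash (v , w , v~w , v~xy , w~xy) = proper v w v~w (trans (colour v~xy) (sym (colour w~xy)))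

vertex : ∀ {n i} → i < n → ∃[ v ] toℕ {n} v ≡ i
vertex i<n = fromℕ< i<n , toℕ-fromℕ< i<n

Neighbour : (n k i j : ℕ) → Set
Neighbour n k i j = j < n × j ≢ i × ∣ i - j ∣ ≤ k

module _ {n k : ℕ} where

  adj⇒neighbour : ∀ {v u : Fin n} → Adj (PathPower n k) v u → Neighbour n k (toℕ v) (toℕ u)
  adj⇒neighbour {v} {u} (v≢u , d) = toℕ<n u , (λ u≡v → v≢u (toℕ-injective (sym u≡v))) , d

  neighbour⇒adj : ∀ {v u : Fin n} → Neighbour n k (toℕ v) (toℕ u) → Adj (PathPower n k) v u
  neighbour⇒adj (_ , u≢v , d) = (λ v≡u → u≢v (cong toℕ (sym v≡u))) , d

  neighbour-vertex : ∀ (v : Fin n) {j} → Neighbour n k (toℕ v) j →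
                     ∃[ u ] Adj (PathPower n k) v u × toℕ u ≡ j
  neighbour-vertex v nb@(j<n , _) with vertex j<n
  ... | u , refl = u , neighbour⇒adj nb , refl

two-neighbours : ∀ {n k i} → 3 ≤ n → 2 ≤ k → i < n →
                 ∃₂ λ a b → a ≢ b × Neighbour n k i a × Neighbour n k i b
two-neighbours {i = 0} 3≤n 2≤k _ =
  1 , 2 , (λ ()) , (≤-trans (s≤s (s≤s z≤n)) 3≤n , (λ ()) , ≤-trans (s≤s z≤n) 2≤k)
                 , (3≤n , (λ ()) , 2≤k)
two-neighbours {i = 1} 3≤n 2≤k _ =
  0 , 2 , (λ ()) , (≤-trans (s≤s z≤n) 3≤n , (λ ()) , ≤-trans (s≤s z≤n) 2≤k)
                 , (3≤n , (λ ()) , ≤-trans (s≤s z≤n) 2≤k)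
two-neighbours {k = k} {i = suc (suc j)} 3≤n 2≤k i<n =
  suc j , j , 1+n≢n ,
  (<⇒≤ i<n , <⇒≢ (n<1+n _) ,
   ∣-∣≤-intro (m<m+n (suc j) (≤-trans (s≤s z≤n) 2≤k)) (≤-trans (n≤1+n _) (m≤m+n _ k))) ,
  (≤-trans (n≤1+n _) (<⇒≤ i<n) , <⇒≢ (≤-trans (n<1+n j) (n≤1+n _)) ,
   ∣-∣≤-intro (subst (_≤ j + k) (+-comm j 2) (+-monoʳ-≤ j 2≤k))
              (≤-trans (≤-trans (n≤1+n _) (n≤1+n _)) (m≤m+n _ k)))

module _ {n k : ℕ} (3≤n : 3 ≤ n) (2≤k : 2 ≤ k) where

  degree≥2 : ∀ v → DegAtLeast2 (PathPower n k) v
  degree≥2 v with two-neighbours 3≤n 2≤k (toℕ<n v)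
  ... | a , b , a≢b , na , nb with neighbour-vertex v na | neighbour-vertex v nb
  ... | u , v~u , refl | w , v~w , refl = u , w , a≢b ∘ cong toℕ , v~u , v~w

  no-leaf : ∀ v → ¬ DegOne (PathPower n k) v
  no-leaf v (_ , _ , unique) with degree≥2 v
  ... | a , b , a≢b , v~a , v~b = a≢b (trans (unique a v~a) (sym (unique b v~b)))

module _ {n k : ℕ} where

  Universal : ℕ → Set
  Universal i = n ≤ suc (i + k) × i ≤ k

  universal? : ∀ i → Dec (Universal i)
  universal? i = n ≤? suc (i + k) ×-dec i ≤? k

  universal-adj : ∀ {u v : Fin n} → Universal (toℕ u) → v ≢ u → Adj (PathPower n k) v u
  universal-adj {u} {v} (n≤1+u+k , u≤k) v≢u =
    v≢u , ∣-∣≤-intro (s≤s⁻¹ (≤-trans (toℕ<n v) n≤1+u+k)) (≤-trans u≤k (m≤n+m k (toℕ v)))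

  consecutive-universals : k < n → n ≤ k + k → ∃[ t ] suc t < n × Universal t × Universal (suc t)
  consecutive-universals k<n n≤2k =
    t , ≤-<-trans t<k k<n , (n≤1+t+k , <⇒≤ t<k) , (≤-trans n≤1+t+k (n≤1+n _) , t<k)
    where
    t = n ∸ suc k
    n≤1+t+k : n ≤ suc (t + k)
    n≤1+t+k = ≤-reflexive (trans (sym (m∸n+n≡m k<n)) (+-suc t k))
    t<k : t < k
    t<k = subst (_≤ k) (+-∸-assoc 1 k<n) (m≤n+o⇒m∸n≤o n k n≤2k)

  AdjacentNeighboursAvoiding : Fin n → Fin n → Set
  AdjacentNeighboursAvoiding b a =
    ∃₂ λ v w → Adj (PathPower n k) v w × (Adj (PathPower n k) v b × v ≢ a)
                                       × (Adj (PathPower n k) w b × w ≢ a)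

  pair-in-window : ∀ {s} → 3 ≤ k → (a b : Fin n) → s ≤ toℕ b → toℕ b ≤ s + 3 → s + 3 < n →
                   AdjacentNeighboursAvoiding b a
  pair-in-window {s} 3≤k a b s≤b b≤s+3 s+3<n
    with gap-in-interval (toℕ a ∷ toℕ b ∷ []) s
  ... | i , s≤i , i≤s+2 , i∉ab
    with gap-in-interval (i ∷ toℕ a ∷ toℕ b ∷ []) s
  ... | j , s≤j , j≤s+3 , j∉iab
    with vertex (≤-<-trans (≤-trans i≤s+2 (+-monoʳ-≤ s (n≤1+n 2))) s+3<n)
       | vertex (≤-<-trans j≤s+3 s+3<n)
  ... | v , refl | w , refl =
    v , w , in-window s≤i i≤s+3 s≤j j≤s+3 (λ v≡w → j∉iab (here (cong toℕ (sym v≡w)))) ,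
    (in-window s≤i i≤s+3 s≤b b≤s+3 (λ v≡b → i∉ab (there (here (cong toℕ v≡b)))) ,
     λ v≡a → i∉ab (here (cong toℕ v≡a))) ,
    (in-window s≤j j≤s+3 s≤b b≤s+3 (λ w≡b → j∉iab (there (there (here (cong toℕ w≡b))))) ,
     λ w≡a → j∉iab (there (here (cong toℕ w≡a))))
    where
    i≤s+3 = ≤-trans i≤s+2 (+-monoʳ-≤ s (n≤1+n 2))
    in-window : ∀ {u v : Fin n} → s ≤ toℕ u → toℕ u ≤ s + 3 → s ≤ toℕ v → toℕ v ≤ s + 3 →
                u ≢ v → Adj (PathPower n k) u v
    in-window s≤u u≤s+3 s≤v v≤s+3 u≢v = u≢v , ∣-∣≤-intro (within u≤s+3 s≤v) (within v≤s+3 s≤u)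
      where
      within : ∀ {a b} → a ≤ s + 3 → s ≤ b → a ≤ b + k
      within a≤s+3 s≤b = ≤-trans a≤s+3 (+-mono-≤ s≤b 3≤k)

  window-pair : 3 ≤ k → k < n → (a b : Fin n) → AdjacentNeighboursAvoiding b a
  window-pair 3≤k k<n a b = pair-in-window 3≤k a b (m⊓n≤m _ _) b≤s+3 s+3<n
    where
    s = toℕ b ⊓ (n ∸ 4)
    n≡[n∸4]+4 : n ≡ n ∸ 4 + 4
    n≡[n∸4]+4 = sym (m∸n+n≡m (≤-trans (s≤s 3≤k) k<n))
    b≤s+3 : toℕ b ≤ s + 3
    b≤s+3 = subst (toℕ b ≤_) (sym (+-distribʳ-⊓ 3 (toℕ b) (n ∸ 4)))
              (⊓-glb (m≤m+n (toℕ b) 3)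
                     (s≤s⁻¹ (subst (toℕ b <_) (trans n≡[n∸4]+4 (+-suc _ 3)) (toℕ<n b))))
    s+3<n : s + 3 < n
    s+3<n = subst (_≤ n) (+-suc s 3) (subst (s + 4 ≤_) (sym n≡[n∸4]+4) (+-monoˡ-≤ 4 (m⊓n≤n _ _)))

  common-neighbours-with-universal : ∀ {a} b → Universal (toℕ a) → AdjacentNeighboursAvoiding b a →
                                     AdjacentCommonNeighbours (PathPower n k) a b
  common-neighbours-with-universal b a-univ (v , w , v~w , (v~b , v≢a) , (w~b , w≢a)) =
    v , w , v~w , (universal-adj a-univ v≢a , v~b) , (universal-adj a-univ w≢a , w~b)

  universal-adj-nonuniversal : ∀ {u v : Fin n} → Universal (toℕ u) → ¬ Universal (toℕ v) →
                               Adj (PathPower n k) u v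
  universal-adj-nonuniversal u-univ ¬v-univ = Adj-sym (PathPower n k)
    (universal-adj u-univ (λ v≡u → ¬v-univ (subst (Universal ∘ toℕ) (sym v≡u) u-univ)))

  common-neighbours-without-universal : k < n → n ≤ k + k → ∀ {a b} →
    ¬ Universal (toℕ a) → ¬ Universal (toℕ b) → AdjacentCommonNeighbours (PathPower n k) a b
  common-neighbours-without-universal k<n n≤2k ¬a-univ ¬b-univ with consecutive-universals k<n n≤2k
  ... | t , 1+t<n , t-univ , 1+t-univ with vertex (<-trans (n<1+n t) 1+t<n) | vertex 1+t<n
  ...   | u , refl | w , w≡1+u =
    u , w , universal-adj w-univ (λ u≡w → 1+n≢n (trans (sym w≡1+u) (cong toℕ (sym u≡w)))) ,
    (universal-adj-nonuniversal t-univ ¬a-univ , universal-adj-nonuniversal t-univ ¬b-univ) ,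
    (universal-adj-nonuniversal w-univ ¬a-univ , universal-adj-nonuniversal w-univ ¬b-univ)
    where
    w-univ : Universal (toℕ w)
    w-univ = subst Universal (sym w≡1+u) 1+t-univ

  adjacent-common-neighbours : 3 ≤ k → k < n → n ≤ k + k →
                               ∀ a b → AdjacentCommonNeighbours (PathPower n k) a b
  adjacent-common-neighbours 3≤k k<n n≤2k a b with universal? (toℕ a) | universal? (toℕ b)
  ... | yes a-univ | _          = common-neighbours-with-universal b a-univ (window-pair 3≤k k<n a b)
  ... | no _       | yes b-univ =
    common-neighbours-sym {PathPower n k} (common-neighbours-with-universal a b-univ (window-pair 3≤k k<n b a))
  ... | no ¬a-univ | no ¬b-univ = common-neighbours-without-universal k<n n≤2k ¬a-univ ¬b-univ

predecessor-neighbour : ∀ {n k i} → 1 ≤ k → 1 ≤ i → i < n → Neighbour n k i (pred i)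
predecessor-neighbour {k = k} {i = suc i} 1≤k _ i<n =
  <⇒≤ i<n , <⇒≢ (n<1+n i) , ∣-∣≤-intro (m<m+n i 1≤k) (≤-trans (n≤1+n i) (m≤m+n _ k))

-- The vertices of P_(n′+1)^k are 0 … n′.
module Extremes (n′ k : ℕ) where

  maxNeighbour : ℕ → ℕ
  maxNeighbour i with i ≟ n′
  ... | yes _ = pred i
  ... | no  _ = (i + k) ⊓ n′

  minNeighbour : ℕ → ℕ
  minNeighbour zero    = 1
  minNeighbour (suc i) = suc i ∸ k

  maxNeighbour-inner : ∀ {i} → i ≢ n′ → maxNeighbour i ≡ (i + k) ⊓ n′
  maxNeighbour-inner {i} i≢n′ with i ≟ n′
  ... | yes i≡n′ = ⊥-elim (i≢n′ i≡n′)
  ... | no _ = refl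

  module _ (2≤n′ : 2 ≤ n′) (2≤k : 2 ≤ k) where

    private
      1≤n′ = ≤-trans (n≤1+n 1) 2≤n′
      1≤k  = ≤-trans (n≤1+n 1) 2≤k

    maxNeighbour-neighbour : ∀ {i} → i < suc n′ → Neighbour (suc n′) k i (maxNeighbour i)
    maxNeighbour-neighbour {i} i<n with i ≟ n′
    ... | yes refl = predecessor-neighbour 1≤k 1≤n′ i<n
    ... | no i≢n′ = s≤s (m⊓n≤n _ _) , (λ t≡i → <⇒≢ i<t (sym t≡i)) ,
                    ∣-∣≤-intro (≤-trans (<⇒≤ i<t) (m≤m+n _ k)) (m⊓n≤m _ _)
      where
      i<t : i < (i + k) ⊓ n′
      i<t = ⊓-pres-m< (m<m+n i 1≤k) (≤∧≢⇒< (s≤s⁻¹ i<n) i≢n′)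

    maxNeighbour-greatest : ∀ {i j} → Neighbour (suc n′) k i j → j ≤ maxNeighbour i
    maxNeighbour-greatest {i} {j} (j<n , j≢i , d) with i ≟ n′
    ... | yes refl = <⇒≤pred (≤∧≢⇒< (s≤s⁻¹ j<n) j≢i)
    ... | no _ = ⊓-glb (proj₂ (∣-∣≤-elim d)) (s≤s⁻¹ j<n)

    minNeighbour-neighbour : ∀ {i} → i < suc n′ → Neighbour (suc n′) k i (minNeighbour i)
    minNeighbour-neighbour {zero} _ = s≤s 1≤n′ , (λ ()) , 1≤k
    minNeighbour-neighbour {suc i} i<n =
      ≤-<-trans (m∸n≤m (suc i) k) i<n , <⇒≢ (s≤s (∸-monoʳ-≤ (suc i) 1≤k)) ,
      ∣-∣≤-intro (≤-trans (m≤n+m∸n (suc i) k) (≤-reflexive (+-comm k _)))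
                 (≤-trans (m∸n≤m (suc i) k) (m≤m+n _ k))

    minNeighbour-least : ∀ {i j} → Neighbour (suc n′) k i j → minNeighbour i ≤ j
    minNeighbour-least {zero} (_ , j≢0 , _) = n≢0⇒n>0 j≢0
    minNeighbour-least {suc i} {j} (_ , _ , d) =
      m≤n+o⇒m∸n≤o (suc i) k (subst (suc i ≤_) (+-comm j k) (proj₁ (∣-∣≤-elim d)))

    minNeighbour<maxNeighbour : ∀ {i} → i < suc n′ → minNeighbour i < maxNeighbour i
    minNeighbour<maxNeighbour i<n with two-neighbours (s≤s 2≤n′) 2≤k i<n
    ... | a , b , a≢b , a-nb , b-nb =
      ≤∧≢⇒< (≤-trans (minNeighbour-least a-nb) (maxNeighbour-greatest a-nb))
            (λ min≡max → a≢b (trans (squeeze a-nb min≡max) (sym (squeeze b-nb min≡max))))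
      where
      squeeze : ∀ {i j} → Neighbour (suc n′) k i j → minNeighbour i ≡ maxNeighbour i → j ≡ maxNeighbour i
      squeeze j-nb min≡max =
        ≤-antisym (maxNeighbour-greatest j-nb) (subst (_≤ _) min≡max (minNeighbour-least j-nb))

    -- Vertex 0 has the smallest maxNeighbour, vertices i ≤ k have distinct maxNeighbours i + k
    -- (as 2k < n), and beyond k the minNeighbours i ∸ k are distinct.
    extremes-separate : k + k ≤ n′ → ∀ {i j} → i < j → j < suc n′ →
                        minNeighbour i ≢ minNeighbour j ⊎ maxNeighbour i ≢ maxNeighbour j
    extremes-separate 2k≤n′ {zero} {j} 0<j j<n =
      inj₂ (λ max0≡maxj → <⇒≢ (k<maxNeighbour 0<j j<n) (trans (sym max0≡k) max0≡maxj))
      where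
      k<n′ : k < n′
      k<n′ = ≤-trans (m<m+n k 1≤k) 2k≤n′
      max0≡k : maxNeighbour 0 ≡ k
      max0≡k = trans (maxNeighbour-inner (<⇒≢ (≤-<-trans z≤n k<n′))) (m≤n⇒m⊓n≡m (<⇒≤ k<n′))
      k<maxNeighbour : ∀ {j} → 1 ≤ j → j < suc n′ → k < maxNeighbour j
      k<maxNeighbour {j} 1≤j j<n with j ≟ n′
      ... | yes refl =
        suc[m]≤n⇒m≤pred[n] (≤-trans (subst (_≤ k + k) (+-comm k 2) (+-monoʳ-≤ k 2≤k)) 2k≤n′)
      ... | no _ = ⊓-pres-m< (m<n+m k 1≤j) k<n′
    extremes-separate 2k≤n′ {suc i} {suc j} 1+i<1+j j<n with suc j ≤? k
    ... | yes 1+j≤k = inj₂ (λ maxi≡maxj →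
      <⇒≢ (≤-<-trans maxi≤1+i+k (+-monoˡ-< k 1+i<1+j)) (trans maxi≡maxj maxj≡1+j+k))
      where
      maxi≤1+i+k : maxNeighbour (suc i) ≤ suc i + k
      maxi≤1+i+k = proj₂ (∣-∣≤-elim (proj₂ (proj₂ (maxNeighbour-neighbour (<-trans 1+i<1+j j<n)))))
      1+j+k≤n′ : suc j + k ≤ n′
      1+j+k≤n′ = ≤-trans (+-monoˡ-≤ k 1+j≤k) 2k≤n′
      maxj≡1+j+k : maxNeighbour (suc j) ≡ suc j + k
      maxj≡1+j+k = trans (maxNeighbour-inner (<⇒≢ (≤-trans (m<m+n (suc j) 1≤k) 1+j+k≤n′)))
                         (m≤n⇒m⊓n≡m 1+j+k≤n′)
    ... | no 1+j≰k = inj₁ (<⇒≢ (∸-monoˡ-<′ 1+i<1+j (≰⇒> 1+j≰k)))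

module _ {n′ k : ℕ} (2≤n′ : 2 ≤ n′) (2≤k : 2 ≤ k) where
  open Extremes n′ k

  power-labelling : (∀ {i j} → i < j → j < suc n′ →
                      minNeighbour i ≢ minNeighbour j ⊎ maxNeighbour i ≢ maxNeighbour j) →
                    GapLabelling (PathPower (suc n′) k) (2 ^ suc n′)
  power-labelling separate = record
    { π       = λ v → 2 ^ toℕ v
    ; c       = colour ∘ toℕ
    ; π-range = λ v → m^n>0 2 (toℕ v) , ^-monoʳ-≤ 2 (<⇒≤ (toℕ<n v))
    ; c-range = λ v → ≤-trans (m∸n≤m _ (2 ^ minNeighbour (toℕ v)))
                              (^-monoʳ-≤ 2 (<⇒≤ (proj₁ (maxNeighbour-neighbour 2≤n′ 2≤k (toℕ<n v)))))
    ; proper  = proper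
    ; gap≥2   = λ v _ → gap v
    ; gap1    = λ v leaf → ⊥-elim (no-leaf (s≤s 2≤n′) 2≤k v leaf)
    }
    where
    G = PathPower (suc n′) k
    colour : ℕ → ℕ
    colour i = 2 ^ maxNeighbour i ∸ 2 ^ minNeighbour i

    min<max : ∀ {i} → i < suc n′ → minNeighbour i < maxNeighbour i
    min<max = minNeighbour<maxNeighbour 2≤n′ 2≤k

    distinct : ∀ {i j} → i < j → j < suc n′ → colour i ≢ colour j
    distinct i<j j<n ci≡cj
      with 2^∸2^-injective (min<max (<-trans i<j j<n)) (min<max j<n) ci≡cj | separate i<j j<n
    ... | min≡ , _ | inj₁ min≢ = min≢ min≡
    ... | _ , max≡ | inj₂ max≢ = max≢ max≡

    proper : ∀ u v → Adj G u v → colour (toℕ u) ≢ colour (toℕ v)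
    proper u v (u≢v , _) with <-cmp (toℕ u) (toℕ v)
    ... | tri< u<v _ _ = distinct u<v (toℕ<n v)
    ... | tri≈ _ u≡v _ = ⊥-elim (u≢v (toℕ-injective u≡v))
    ... | tri> _ _ v<u = distinct v<u (toℕ<n u) ∘ sym

    gap : ∀ v → ∃[ M ] ∃[ μ ] (IsMaxN G (λ u → 2 ^ toℕ u) v M × IsMinN G (λ u → 2 ^ toℕ u) v μ
                               × colour (toℕ v) ≡ M ∸ μ)
    gap v with neighbour-vertex v (maxNeighbour-neighbour 2≤n′ 2≤k (toℕ<n v))
             | neighbour-vertex v (minNeighbour-neighbour 2≤n′ 2≤k (toℕ<n v))
    ... | u , v~u , u≡max | w , v~w , w≡min =
      2 ^ maxNeighbour (toℕ v) , 2 ^ minNeighbour (toℕ v) ,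
      ((u , v~u , cong (2 ^_) u≡max) ,
       λ x v~x → ^-monoʳ-≤ 2 (maxNeighbour-greatest 2≤n′ 2≤k (adj⇒neighbour v~x))) ,
      ((w , v~w , cong (2 ^_) w≡min) ,
       λ x v~x → ^-monoʳ-≤ 2 (minNeighbour-least 2≤n′ 2≤k (adj⇒neighbour v~x))) ,
      refl

sparse-power-labelling : ∀ {n k} → 2 ≤ k → 2 * k < n → GapLabelling (PathPower n k) (2 ^ n)
sparse-power-labelling {suc n′} {k} 2≤k 2k<n =
  power-labelling 2≤n′ 2≤k (Extremes.extremes-separate n′ k 2≤n′ 2≤k 2k≤n′)
  where
  2k≤n′ : k + k ≤ n′
  2k≤n′ = subst (_≤ n′) (2*m≡m+m k) (s≤s⁻¹ 2k<n)
  2≤n′ : 2 ≤ n′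
  2≤n′ = ≤-trans 2≤k (≤-trans (m≤m+n k k) 2k≤n′)

module GapLabellingDecision (G : Graph) (adj? : ∀ u v → Dec (Adj G u v)) where

  GapColoured : (π c : Fin (size G) → ℕ) → Fin (size G) → Set
  GapColoured π c v = ∃₂ λ u w → IsMaxN G π v (π u) × IsMinN G π v (π w) × c v ≡ π u ∸ π w

  IsGapLabelling : ℕ → (π c : Fin (size G) → ℕ) → Set
  IsGapLabelling m π c = (∀ v → 1 ≤ π v × π v ≤ m) × (∀ v → c v ≤ m)
                       × (∀ u v → Adj G u v → c u ≢ c v) × (∀ v → GapColoured π c v)

  isGapLabelling? : ∀ m π c → Dec (IsGapLabelling m π c)
  isGapLabelling? m π c =
    all? (λ v → 1 ≤? π v ×-dec π v ≤? m) ×-dec all? (λ v → c v ≤? m) ×-dec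
    all? (λ u → all? λ v → adj? u v →-dec ¬? (c u ≟ c v)) ×-dec
    all? (λ v → any? λ u → any? λ w → isMax? v (π u) ×-dec isMin? v (π w) ×-dec c v ≟ π u ∸ π w)
    where
    isMax? : ∀ v x → Dec (IsMaxN G π v x)
    isMax? v x = any? (λ u → adj? v u ×-dec π u ≟ x) ×-dec all? (λ u → adj? v u →-dec π u ≤? x)
    isMin? : ∀ v x → Dec (IsMinN G π v x)
    isMin? v x = any? (λ u → adj? v u ×-dec π u ≟ x) ×-dec all? (λ u → adj? v u →-dec x ≤? π u)

  toGapLabelling : ∀ {m π c} → (∀ v → ¬ DegOne G v) → IsGapLabelling m π c → GapLabelling G m
  toGapLabelling {m} {π} {c} no-leaf (π-range , c-range , proper , coloured) = record
    { π = π ; c = c ; π-range = π-range ; c-range = c-range ; proper = proper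
    ; gap≥2 = λ v _ → let (u , w , max , min , c≡) = coloured v in π u , π w , max , min , c≡
    ; gap1  = λ v leaf → ⊥-elim (no-leaf v leaf)
    }

adj? : ∀ {n k} (u v : Fin n) → Dec (Adj (PathPower n k) u v)
adj? {k = k} u v = ¬? (u Fin.≟ v) ×-dec ∣ toℕ u - toℕ v ∣ ≤? k

P₃²-labelling : GapLabelling (PathPower 3 2) 4
P₃²-labelling = toGapLabelling (no-leaf (s≤s (s≤s (s≤s z≤n))) (s≤s (s≤s z≤n)))
  (from-yes (isGapLabelling? 4 (Vec.lookup (1 ∷ 2 ∷ 4 ∷ [])) (Vec.lookup (2 ∷ 3 ∷ 1 ∷ []))))
  where open GapLabellingDecision (PathPower 3 2) adj?

P₄²-labelling : GapLabelling (PathPower 4 2) 4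
P₄²-labelling = toGapLabelling (no-leaf (s≤s (s≤s (s≤s z≤n))) (s≤s (s≤s z≤n)))
  (from-yes (isGapLabelling? 4 (Vec.lookup (1 ∷ 2 ∷ 4 ∷ 1 ∷ [])) (Vec.lookup (2 ∷ 3 ∷ 1 ∷ 2 ∷ []))))
  where open GapLabellingDecision (PathPower 4 2) adj?

≅-refl : ∀ {G} → G ≅ G
≅-refl = ↔-id _ , λ _ _ → id , id

gapLabelling-≅ : ∀ {G H m} → G ≅ H → GapLabelling H m → GapLabelling G m
gapLabelling-≅ {G} {H} {m} (f , adj⇔) L = record
  { π       = π ∘ to
  ; c       = c ∘ to
  ; π-range = π-range ∘ to
  ; c-range = c-range ∘ to
  ; proper  = λ u v u~v → proper (to u) (to v) (preserve u~v)
  ; gap≥2   = λ v deg → let (M , μ , max , min , c≡) = gap≥2 (to v) (degree≥2-to deg)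
                        in M , μ , maxN max , minN min , c≡
  ; gap1    = λ v leaf u v~u → gap1 (to v) (degree1-to leaf) (to u) (preserve v~u)
  }
  where
  open Inverse f
  open GapLabelling L

  preserve : ∀ {u v} → Adj G u v → Adj H (to u) (to v)
  preserve = proj₁ (adj⇔ _ _)

  reflect : ∀ {v w} → Adj H (to v) w → Adj G v (from w)
  reflect {v} {w} v~w = proj₂ (adj⇔ _ _) (subst (Adj H (to v)) (sym (strictlyInverseˡ w)) v~w)

  to-injective : ∀ {u w} → to u ≡ to w → u ≡ w
  to-injective {u} {w} e = trans (sym (strictlyInverseʳ u)) (trans (cong from e) (strictlyInverseʳ w))

  degree≥2-to : ∀ {v} → DegAtLeast2 G v → DegAtLeast2 H (to v)
  degree≥2-to (u , w , u≢w , v~u , v~w) = to u , to w , u≢w ∘ to-injective , preserve v~u , preserve v~w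

  degree1-to : ∀ {v} → DegOne G v → DegOne H (to v)
  degree1-to (u , v~u , unique) =
    to u , preserve v~u , λ w v~w → trans (sym (strictlyInverseˡ w)) (cong to (unique (from w) (reflect v~w)))

  maxN : ∀ {v M} → IsMaxN H π (to v) M → IsMaxN G (π ∘ to) v M
  maxN ((u , v~u , πu≡M) , bound) =
    (from u , reflect v~u , trans (cong π (strictlyInverseˡ u)) πu≡M) , λ w v~w → bound (to w) (preserve v~w)

  minN : ∀ {v μ} → IsMinN H π (to v) μ → IsMinN G (π ∘ to) v μ
  minN ((u , v~u , πu≡μ) , bound) =
    (from u , reflect v~u , trans (cong π (strictlyInverseˡ u)) πu≡μ) , λ w v~w → bound (to w) (preserve v~w)

small-path-powers : ∀ {n} → 3 ≤ n → n ≤ 4 →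
                    (PathPower n 2 ≅ PathPower 3 2) ⊎ (PathPower n 2 ≅ PathPower 4 2)
small-path-powers {1} (s≤s ()) _
small-path-powers {2} (s≤s (s≤s ())) _
small-path-powers {3} _ _ = inj₁ (≅-refl {PathPower 3 2})
small-path-powers {4} _ _ = inj₂ (≅-refl {PathPower 4 2})
small-path-powers {suc (suc (suc (suc (suc _))))} _ (s≤s (s≤s (s≤s (s≤s ()))))

theorem5 : (n k : ℕ) → 3 ≤ n → 2 ≤ k → k < n →
    GapVertexLabelable (PathPower n k)
      ⇔ ((PathPower n k ≅ PathPower 3 2) ⊎ (PathPower n k ≅ PathPower 4 2)
          ⊎ (5 ≤ n × 2 * k < n))
theorem5 n k 3≤n 2≤k k<n = mk⇔ labelable⇒ ⇒labelable
  where
  ⇒labelable : (PathPower n k ≅ PathPower 3 2) ⊎ (PathPower n k ≅ PathPower 4 2) ⊎ (5 ≤ n × 2 * k < n) →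
               GapVertexLabelable (PathPower n k)
  ⇒labelable (inj₁ G≅P₃²)              = 4 , gapLabelling-≅ G≅P₃² P₃²-labelling
  ⇒labelable (inj₂ (inj₁ G≅P₄²))       = 4 , gapLabelling-≅ G≅P₄² P₄²-labelling
  ⇒labelable (inj₂ (inj₂ (_ , 2k<n))) = 2 ^ n , sparse-power-labelling 2≤k 2k<n

  labelable⇒ : GapVertexLabelable (PathPower n k) →
               (PathPower n k ≅ PathPower 3 2) ⊎ (PathPower n k ≅ PathPower 4 2) ⊎ (5 ≤ n × 2 * k < n)
  labelable⇒ (m , L) with 2 * k <? n | 3 ≤? k
  ... | yes 2k<n | _     = inj₂ (inj₂ (≤-trans (s≤s (*-monoʳ-≤ 2 2≤k)) 2k<n , 2k<n))
  ... | no 2k≮n  | yes 3≤k =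
    ⊥-elim (no-gap-labelling (fromℕ< (≤-trans (s≤s z≤n) 3≤n))
                             (adjacent-common-neighbours 3≤k k<n (subst (n ≤_) (2*m≡m+m k) (≮⇒≥ 2k≮n))) L)
  ... | no 2k≮n  | no 3≰k with ≤-antisym (s≤s⁻¹ (≰⇒> 3≰k)) 2≤k
  ...   | refl = map₂ inj₁ (small-path-powers 3≤n (≮⇒≥ 2k≮n))
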